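{- Let $P=\mathbb{P}V_3\subset\operatorname{PG}(3,3)$ be a plane containing none of the four points $\langle1000\rangle,\langle0100\rangle,\langle0010\rangle,\langle0001\rangle$. Then among the $13$ lines of $P$ there are exactly $3$ lines of weight pattern $(0,2,0,2)$ (kind $\Lambda_4$), exactly $6$ lines of weight pattern $(0,1,2,1)$ (kind $\Lambda_6$), and exactly $4$ lines of weight pattern $(0,3,1,0)$ (kind $\Lambda_3$); these are the three $\mathcal{G}(\mathcal{L}_4)$-orbits of lines in $P$.
   Context: $\operatorname{PG}(3,3)=\mathbb{P}(\mathbb{F}_3^4)$ with standard basis $\varepsilon_1=1000,\varepsilon_2=0100,\varepsilon_3=0010,\varepsilon_4=0001$; $\operatorname{wt}_\varepsilon$ is the number of nonzero coordinates. A line $L$ of $\operatorname{PG}(3,3)$ has weight pattern $(n_1,n_2,n_3,n_4)$ if exactly $n_w$ of its four points $\langle\xi\rangle$ have $\operatorname{wt}_\varepsilon(\xi)=w$. The group $\mathcal{G}(\mathcal{L}_4)$ acts on $\operatorname{PG}(3,3)$ through monomial transformations (coordinate permutations and sign changes $\xi_i\mapsto\pm\xi_i$), which preserve weight patterns; lines are classified into seven kinds $\Lambda_1,\dots,\Lambda_7$ by weight pattern. -}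

module Defs where

open import Data.Nat using (ℕ; zero; suc; _<ᵇ_)
import Data.Nat as ℕ
open import Data.Bool using (Bool; true; false; _∧_; if_then_else_)
open import Data.Fin using (Fin; toℕ) renaming (zero to fz; suc to fs)
open import Data.Vec using (Vec; []; _∷_; zipWith; map; foldr; lookup; tabulate)
open import Data.List using (List; []; _∷_; filter; cartesianProduct; concatMap; length)
import Data.List as List
open import Data.Maybe using (Maybe; just; nothing)
open import Data.Product using (_×_; _,_; proj₁; proj₂)
open import Data.Product.Properties using (≡-dec)
open import Relation.Binary.PropositionalEquality using (_≡_; refl)
open import Relation.Nullary using (Dec; yes; no; ¬_)
open import Relation.Binary using (DecidableEquality)

data F3 : Set where
  0# 1# 2# : F3

_+F_ : F3 → F3 → F3
0# +F y  = y
x  +F 0# = x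
1# +F 1# = 2#
1# +F 2# = 0#
2# +F 1# = 0#
2# +F 2# = 1#

_*F_ : F3 → F3 → F3
0# *F _  = 0#
_  *F 0# = 0#
1# *F y  = y
2# *F 1# = 2#
2# *F 2# = 1#

_≟F_ : DecidableEquality F3
0# ≟F 0# = yes refl
1# ≟F 1# = yes refl
2# ≟F 2# = yes refl
0# ≟F 1# = no λ ()
0# ≟F 2# = no λ ()
1# ≟F 0# = no λ ()
1# ≟F 2# = no λ ()
2# ≟F 0# = no λ ()
2# ≟F 1# = no λ ()

isZeroᵇ : F3 → Bool
isZeroᵇ 0# = true
isZeroᵇ _  = false

allF3 : List F3
allF3 = 0# ∷ 1# ∷ 2# ∷ []

V : Set
V = Vec F3 4

zeroV : V
zeroV = 0# ∷ 0# ∷ 0# ∷ 0# ∷ []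

_+V_ : V → V → V
_+V_ = zipWith _+F_

_·V_ : F3 → V → V
c ·V v = map (c *F_) v

dot : V → V → F3
dot a x = foldr (λ _ → F3) _+F_ 0# (zipWith _*F_ a x)

ε : Fin 4 → V
ε i = tabulate (λ j → if (toℕ i ℕ.≡ᵇ toℕ j) then 1# else 0#)

allV : List V
allV = concatMap (λ a → concatMap (λ b → concatMap (λ c → List.map (λ d →
         a ∷ b ∷ c ∷ d ∷ []) allF3) allF3) allF3) allF3

wt : V → ℕ
wt v = foldr (λ _ → ℕ) (λ c n → if isZeroᵇ c then n else suc n) 0 v

-- Lines of PG(3,3) = 2-dimensional subspaces of V, each represented by its
-- unique basis (u , v) in reduced row echelon form.

lead : ∀ {n} → Vec F3 n → Maybe (ℕ × F3)
lead [] = nothing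
lead (0# ∷ xs) with lead xs
... | nothing = nothing
... | just (i , c) = just (suc i , c)
lead (c ∷ xs) = just (0 , c)

isOneᵇ : F3 → Bool
isOneᵇ 1# = true
isOneᵇ _  = false

lookupℕ : ∀ {n} → Vec F3 n → ℕ → F3
lookupℕ [] _ = 0#
lookupℕ (x ∷ xs) zero = x
lookupℕ (x ∷ xs) (suc k) = lookupℕ xs k

isRREFᵇ : V → V → Bool
isRREFᵇ u v with lead u | lead v
... | just (i , c) | just (j , d) = isOneᵇ c ∧ isOneᵇ d ∧ (i <ᵇ j) ∧ isZeroᵇ (lookupℕ u j)
... | _ | _ = false

Line : Set
Line = V × V

allLines : List Line
allLines = filter (λ p → isRREFᵇ (proj₁ p) (proj₂ p) Data.Bool.≟ true) (cartesianProduct allV allV)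

linePoints : Line → List V
linePoints (u , v) = u ∷ v ∷ (u +V v) ∷ (u +V (2# ·V v)) ∷ []

countWt : ℕ → Line → ℕ
countWt w L = length (filter (λ x → wt x ℕ.≟ w) (linePoints L))

Pattern : Set
Pattern = ℕ × ℕ × ℕ × ℕ

weightPattern : Line → Pattern
weightPattern L = countWt 1 L , countWt 2 L , countWt 3 L , countWt 4 L

_≟P_ : DecidableEquality Pattern
_≟P_ = ≡-dec ℕ._≟_ (≡-dec ℕ._≟_ (≡-dec ℕ._≟_ ℕ._≟_))

-- Planes: the plane P = ker(a) = { ⟨x⟩ : a·x = 0 } for a nonzero functional a.

InPlane : V → V → Set
InPlane a x = dot a x ≡ 0#

lineInPlane? : (a : V) → (L : Line) → Dec ((dot a (proj₁ L) ≡ 0#) × (dot a (proj₂ L) ≡ 0#))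
lineInPlane? a (u , v) with dot a u ≟F 0# | dot a v ≟F 0#
... | yes p | yes q = yes (p , q)
... | no ¬p | _ = no λ pq → ¬p (proj₁ pq)
... | yes _ | no ¬q = no λ pq → ¬q (proj₂ pq)

linesIn : V → List Line
linesIn a = filter (lineInPlane? a) allLines

countPattern : V → Pattern → ℕ
countPattern a p = length (filter (λ L → weightPattern L ≟P p) (linesIn a))

-- A plane ker a avoiding the four basis points has a functional a all of whose
-- coordinates are nonzero. Since ker a only depends on ⟨a⟩, we may scale a to
-- a₁ = 1, which leaves the eight planes ker(1, ±1, ±1, ±1); for each of them the
-- thirteen lines and their weight patterns are counted directly.
module Submission where

open import Defs
open import Data.Nat using (ℕ)
open import Data.Fin using (Fin) renaming (zero to fz; suc to fs)
open import Data.List using (List; length; filter)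
open import Data.List.Properties using (filter-≐)
open import Data.Product using (_×_; _,_)
open import Data.Vec using (Vec; []; _∷_; lookup; foldr; zipWith) renaming (map to mapᵥ)
open import Data.Empty using (⊥-elim)
open import Relation.Binary.PropositionalEquality using (_≡_; refl; cong; subst; sym; trans)
open import Relation.Nullary using (¬_)

*F-zeroʳ : ∀ x → x *F 0# ≡ 0#
*F-zeroʳ 0# = refl
*F-zeroʳ 1# = refl
*F-zeroʳ 2# = refl

*F-identityʳ : ∀ x → x *F 1# ≡ x
*F-identityʳ 0# = refl
*F-identityʳ 1# = refl
*F-identityʳ 2# = refl

+F-identityʳ : ∀ x → x +F 0# ≡ x
+F-identityʳ 0# = refl
+F-identityʳ 1# = refl
+F-identityʳ 2# = refl

*F-assoc : ∀ x y z → (x *F y) *F z ≡ x *F (y *F z)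
*F-assoc 0# _  _  = refl
*F-assoc 1# 0# 0# = refl
*F-assoc 1# 0# 1# = refl
*F-assoc 1# 0# 2# = refl
*F-assoc 1# 1# 0# = refl
*F-assoc 1# 1# 1# = refl
*F-assoc 1# 1# 2# = refl
*F-assoc 1# 2# 0# = refl
*F-assoc 1# 2# 1# = refl
*F-assoc 1# 2# 2# = refl
*F-assoc 2# 0# 0# = refl
*F-assoc 2# 0# 1# = refl
*F-assoc 2# 0# 2# = refl
*F-assoc 2# 1# 0# = refl
*F-assoc 2# 1# 1# = refl
*F-assoc 2# 1# 2# = refl
*F-assoc 2# 2# 0# = refl
*F-assoc 2# 2# 1# = refl
*F-assoc 2# 2# 2# = refl

*F-distribˡ-+F : ∀ x y z → x *F (y +F z) ≡ (x *F y) +F (x *F z)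
*F-distribˡ-+F 0# _  _  = refl
*F-distribˡ-+F 1# 0# 0# = refl
*F-distribˡ-+F 1# 0# 1# = refl
*F-distribˡ-+F 1# 0# 2# = refl
*F-distribˡ-+F 1# 1# 0# = refl
*F-distribˡ-+F 1# 1# 1# = refl
*F-distribˡ-+F 1# 1# 2# = refl
*F-distribˡ-+F 1# 2# 0# = refl
*F-distribˡ-+F 1# 2# 1# = refl
*F-distribˡ-+F 1# 2# 2# = refl
*F-distribˡ-+F 2# 0# 0# = refl
*F-distribˡ-+F 2# 0# 1# = refl
*F-distribˡ-+F 2# 0# 2# = refl
*F-distribˡ-+F 2# 1# 0# = refl
*F-distribˡ-+F 2# 1# 1# = refl
*F-distribˡ-+F 2# 1# 2# = refl
*F-distribˡ-+F 2# 2# 0# = refl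
*F-distribˡ-+F 2# 2# 1# = refl
*F-distribˡ-+F 2# 2# 2# = refl

data IsUnit : F3 → Set where
  1ᵘ : IsUnit 1#
  2ᵘ : IsUnit 2#

nonzero⇒unit : ∀ {x} → ¬ x ≡ 0# → IsUnit x
nonzero⇒unit {0#} x≢0 = ⊥-elim (x≢0 refl)
nonzero⇒unit {1#} _   = 1ᵘ
nonzero⇒unit {2#} _   = 2ᵘ

unit-*F : ∀ {x y} → IsUnit x → IsUnit y → IsUnit (x *F y)
unit-*F 1ᵘ 1ᵘ = 1ᵘ
unit-*F 1ᵘ 2ᵘ = 2ᵘ
unit-*F 2ᵘ 1ᵘ = 2ᵘ
unit-*F 2ᵘ 2ᵘ = 1ᵘ

*F-cancelˡ-zero : ∀ {c} → IsUnit c → ∀ y → c *F y ≡ 0# → y ≡ 0#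
*F-cancelˡ-zero 1ᵘ 0# _  = refl
*F-cancelˡ-zero 2ᵘ 0# eq = refl

*F-unit-involutive : ∀ {c} → IsUnit c → ∀ y → c *F (c *F y) ≡ y
*F-unit-involutive 1ᵘ 0# = refl
*F-unit-involutive 1ᵘ 1# = refl
*F-unit-involutive 1ᵘ 2# = refl
*F-unit-involutive 2ᵘ 0# = refl
*F-unit-involutive 2ᵘ 1# = refl
*F-unit-involutive 2ᵘ 2# = refl

dot-ε : ∀ a i → dot a (ε i) ≡ lookup a i
dot-ε (x ∷ y ∷ z ∷ w ∷ []) fz
  rewrite *F-zeroʳ y | *F-zeroʳ z | *F-zeroʳ w | *F-identityʳ x = +F-identityʳ x
dot-ε (x ∷ y ∷ z ∷ w ∷ []) (fs fz)
  rewrite *F-zeroʳ x | *F-zeroʳ z | *F-zeroʳ w | *F-identityʳ y = +F-identityʳ y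
dot-ε (x ∷ y ∷ z ∷ w ∷ []) (fs (fs fz))
  rewrite *F-zeroʳ x | *F-zeroʳ y | *F-zeroʳ w | *F-identityʳ z = +F-identityʳ z
dot-ε (x ∷ y ∷ z ∷ w ∷ []) (fs (fs (fs fz)))
  rewrite *F-zeroʳ x | *F-zeroʳ y | *F-zeroʳ z | *F-identityʳ w = +F-identityʳ w

dot-scaleˡ : ∀ c a x → dot (c ·V a) x ≡ c *F dot a x
dot-scaleˡ c = go
  where
  go : ∀ {n} (a x : Vec F3 n) →
       foldr _ _+F_ 0# (zipWith _*F_ (mapᵥ (c *F_) a) x)
       ≡ c *F foldr _ _+F_ 0# (zipWith _*F_ a x)
  go []       []       = sym (*F-zeroʳ c)
  go (a ∷ as) (x ∷ xs) rewrite go as xs | *F-assoc c a x =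
    sym (*F-distribˡ-+F c (a *F x) _)

PlaneContains : V → Line → Set
PlaneContains a (u , v) = InPlane a u × InPlane a v

linesIn-scale : ∀ {c} → IsUnit c → ∀ a → linesIn (c ·V a) ≡ linesIn a
linesIn-scale {c} c-unit a =
  filter-≐ (lineInPlane? (c ·V a)) (lineInPlane? a) (descend , ascend) allLines
  where
  ascend-point : ∀ x → dot a x ≡ 0# → dot (c ·V a) x ≡ 0#
  ascend-point x ax≡0 rewrite dot-scaleˡ c a x | ax≡0 = *F-zeroʳ c

  descend-point : ∀ x → dot (c ·V a) x ≡ 0# → dot a x ≡ 0#
  descend-point x cax≡0 = *F-cancelˡ-zero c-unit (dot a x) (subst (_≡ 0#) (dot-scaleˡ c a x) cax≡0)

  descend : ∀ {L} → PlaneContains (c ·V a) L → PlaneContains a L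
  descend {u , v} (p , q) = descend-point u p , descend-point v q

  ascend : ∀ {L} → PlaneContains a L → PlaneContains (c ·V a) L
  ascend {u , v} (p , q) = ascend-point u p , ascend-point v q

countIn : List Line → Pattern → ℕ
countIn Ls p = length (filter (λ L → weightPattern L ≟P p) Ls)

PlaneCounts : List Line → Set
PlaneCounts Ls =
    (length Ls ≡ 13)
  × (countIn Ls (0 , 2 , 0 , 2) ≡ 3)
  × (countIn Ls (0 , 1 , 2 , 1) ≡ 6)
  × (countIn Ls (0 , 3 , 1 , 0) ≡ 4)

planeCounts-normalised : ∀ {y z w} → IsUnit y → IsUnit z → IsUnit w →
                         PlaneCounts (linesIn (1# ∷ y ∷ z ∷ w ∷ []))
planeCounts-normalised 1ᵘ 1ᵘ 1ᵘ = refl , refl , refl , refl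
planeCounts-normalised 1ᵘ 1ᵘ 2ᵘ = refl , refl , refl , refl
planeCounts-normalised 1ᵘ 2ᵘ 1ᵘ = refl , refl , refl , refl
planeCounts-normalised 1ᵘ 2ᵘ 2ᵘ = refl , refl , refl , refl
planeCounts-normalised 2ᵘ 1ᵘ 1ᵘ = refl , refl , refl , refl
planeCounts-normalised 2ᵘ 1ᵘ 2ᵘ = refl , refl , refl , refl
planeCounts-normalised 2ᵘ 2ᵘ 1ᵘ = refl , refl , refl , refl
planeCounts-normalised 2ᵘ 2ᵘ 2ᵘ = refl , refl , refl , refl

scale-normalise : ∀ {x} → IsUnit x → ∀ y z w →
                  x ·V (1# ∷ x *F y ∷ x *F z ∷ x *F w ∷ []) ≡ x ∷ y ∷ z ∷ w ∷ []
scale-normalise {x} x-unit y z w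
  rewrite *F-identityʳ x
        | *F-unit-involutive x-unit y
        | *F-unit-involutive x-unit z
        | *F-unit-involutive x-unit w = refl

lemma3 : (a : Defs.V) → ¬ (a ≡ zeroV) → (∀ (i : Fin 4) → ¬ InPlane a (ε i)) →
    (length (linesIn a) ≡ 13)
    × (countPattern a (0 , 2 , 0 , 2) ≡ 3)
    × (countPattern a (0 , 1 , 2 , 1) ≡ 6)
    × (countPattern a (0 , 3 , 1 , 0) ≡ 4)
lemma3 a@(x ∷ y ∷ z ∷ w ∷ []) _ avoids =
  subst PlaneCounts normalised-plane
    (planeCounts-normalised (unit-*F x-unit (unit (fs fz)))
                            (unit-*F x-unit (unit (fs (fs fz))))
                            (unit-*F x-unit (unit (fs (fs (fs fz))))))
  where
  unit : ∀ i → IsUnit (lookup a i)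
  unit i = nonzero⇒unit λ aᵢ≡0 → avoids i (trans (dot-ε a i) aᵢ≡0)

  x-unit : IsUnit x
  x-unit = unit fz

  normalised-plane : linesIn (1# ∷ x *F y ∷ x *F z ∷ x *F w ∷ []) ≡ linesIn a
  normalised-plane = trans (sym (linesIn-scale x-unit (1# ∷ x *F y ∷ x *F z ∷ x *F w ∷ [])))
                           (cong linesIn (scale-normalise x-unit y z w))
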